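{- Let $N = p^k m^2$ be an odd perfect number, where $p$ is a prime with $p \equiv k \equiv 1 \pmod 4$, $k$ a positive integer, $m$ a positive integer and $\gcd(p,m)=1$. Then $\sigma(p^k) \neq \sigma(m^2)$.
   Context: $\sigma(n)$ denotes the sum of the positive divisors of $n$. An odd perfect number is an odd positive integer $N$ with $\sigma(N)=2N$. -}

module Defs where

open import Data.Nat using (ℕ; zero; suc; _+_)
open import Data.Nat.Divisibility using (_∣?_)
open import Data.List using (List; filter; upTo; map)
open import Data.Nat.ListAction using (sum)

-- divisors n = list of d with 1 ≤ d ≤ n and d ∣ n (empty for n = 0)
divisors : ℕ → List ℕ
divisors n = filter (_∣? n) (map suc (upTo n))

σ : ℕ → ℕ
σ n = sum (divisors n)

{-# OPTIONS --safe #-}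
-- Every divisor of an odd number is odd, so σ n ≡ τ n (mod 2) for odd n, where
-- τ n counts the divisors of n. The divisors of p ^ k are p ^ 0, …, p ^ k, so
-- τ (p ^ k) = k + 1 is even when k is odd; the divisors of a square pair off as
-- d ↔ n / d except for its square root, so τ (m ^ 2) is odd. Hence σ (p ^ k) is
-- even and σ (m ^ 2) is odd.
module Submission where

open import Defs
open import Data.Nat using (ℕ; _*_; _^_; _%_; _≥_)
open import Data.Nat.Primality using (Prime)
open import Data.Nat.Coprimality using (Coprime)
open import Relation.Binary.PropositionalEquality using (_≡_)
open import Relation.Nullary using (¬_)

open import Level using (Level)
open import Function using (_∘_)
open import Data.Nat using (zero; suc; _+_; _∸_; _≤_; _<_; z≤n; s≤s; z<s; s<s; NonZero; pred; ≢-nonZero⁻¹; nonTrivial⇒n>1)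
open import Data.Nat.Properties
open import Data.Nat.Solver using (module +-*-Solver)
open import Data.Nat.Divisibility using (_∣_; divides; _∣?_; ∣1⇒≡1; *-cancelʳ-∣; m%n≡0⇒n∣m; n∣m⇒m%n≡0; ∣-trans)
open import Data.Nat.DivMod using (%-distribˡ-+; m%n<n; [m+kn]%n≡m%n; m∣n⇒o%n%m≡o%m)
open import Data.Nat.GCD using (gcd[m,n]∣m; gcd[m,n]∣n)
open import Data.Nat.Coprimality using (gcd≡1⇒coprime; coprime-divisor)
open import Data.Nat.Primality using (prime⇒irreducible; prime⇒nonZero; prime⇒nonTrivial)
open import Data.List using (filter; applyUpTo)
open import Data.List.Properties using (map-applyUpTo)
open import Data.Nat.ListAction using (sum)
open import Data.Product using (∃; _,_; _×_)
open import Data.Sum using (inj₁; inj₂)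
open import Relation.Binary.Definitions using (tri<; tri≈; tri>)
open import Relation.Nullary using (Dec; yes; no; contradiction)
open import Relation.Unary using (Pred; Decidable)
open import Relation.Binary.PropositionalEquality using (refl; sym; trans; cong; cong₂; subst; _≢_; module ≡-Reasoning)

private
  variable
    ℓ : Level
    P : Set ℓ

∑ : ℕ → (ℕ → ℕ) → ℕ
∑ zero    f = 0
∑ (suc n) f = f 0 + ∑ n (λ i → f (suc i))

∑² : ℕ → (ℕ → ℕ → ℕ) → ℕ
∑² n f = ∑ n (λ i → ∑ n (f i))

𝟙 : Dec P → ℕ
𝟙 (yes _) = 1
𝟙 (no _)  = 0

𝟙-yes : (d : Dec P) → P → 𝟙 d ≡ 1
𝟙-yes (yes _) _ = refl
𝟙-yes (no ¬p) p = contradiction p ¬p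

𝟙-no : (d : Dec P) → ¬ P → 𝟙 d ≡ 0
𝟙-no (yes p) ¬p = contradiction p ¬p
𝟙-no (no _)  _  = refl

∑-cong : ∀ n {f g : ℕ → ℕ} → (∀ i → i < n → f i ≡ g i) → ∑ n f ≡ ∑ n g
∑-cong zero    _  = refl
∑-cong (suc n) eq = cong₂ _+_ (eq 0 z<s) (∑-cong n (λ i i<n → eq (suc i) (s<s i<n)))

∑-cong-% : ∀ d .{{_ : NonZero d}} n {f g : ℕ → ℕ} →
           (∀ i → i < n → f i % d ≡ g i % d) → ∑ n f % d ≡ ∑ n g % d
∑-cong-% d zero    _  = refl
∑-cong-% d (suc n) {f} {g} eq = begin
  (f 0 + ∑ n (λ i → f (suc i))) % d           ≡⟨ %-distribˡ-+ (f 0) _ d ⟩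
  (f 0 % d + ∑ n (λ i → f (suc i)) % d) % d
    ≡⟨ cong₂ (λ x y → (x + y) % d) (eq 0 z<s) (∑-cong-% d n (λ i i<n → eq (suc i) (s<s i<n))) ⟩
  (g 0 % d + ∑ n (λ i → g (suc i)) % d) % d   ≡⟨ %-distribˡ-+ (g 0) _ d ⟨
  (g 0 + ∑ n (λ i → g (suc i))) % d           ∎
  where open ≡-Reasoning

∑-+ : ∀ n (f g : ℕ → ℕ) → ∑ n (λ i → f i + g i) ≡ ∑ n f + ∑ n g
∑-+ zero    f g = refl
∑-+ (suc n) f g = trans (cong (f 0 + g 0 +_) (∑-+ n (λ i → f (suc i)) (λ i → g (suc i))))
                        (interchange (f 0) (g 0) _ _)
  where open import Algebra.Properties.CommutativeSemigroup +-commutativeSemigroup using (interchange)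

∑-zero : ∀ n {f : ℕ → ℕ} → (∀ i → i < n → f i ≡ 0) → ∑ n f ≡ 0
∑-zero zero    _      = refl
∑-zero (suc n) vanish = cong₂ _+_ (vanish 0 z<s) (∑-zero n (λ i i<n → vanish (suc i) (s<s i<n)))

∑-single : ∀ n {f : ℕ → ℕ} c → c < n → (∀ i → i < n → i ≢ c → f i ≡ 0) → ∑ n f ≡ f c
∑-single (suc n) {f} zero _ others =
  trans (cong (f 0 +_) (∑-zero n (λ i i<n → others (suc i) (s<s i<n) (λ ())))) (+-identityʳ (f 0))
∑-single (suc n) (suc c) (s<s c<n) others =
  cong₂ _+_ (others 0 z<s (λ ()))
            (∑-single n c c<n (λ i i<n i≢c → others (suc i) (s<s i<n) (i≢c ∘ suc-injective)))

∑-swap : ∀ n k (f : ℕ → ℕ → ℕ) → ∑ n (λ i → ∑ k (f i)) ≡ ∑ k (λ j → ∑ n (λ i → f i j))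
∑-swap zero    k f = sym (∑-zero k (λ _ _ → refl))
∑-swap (suc n) k f = trans (cong (∑ k (f 0) +_) (∑-swap n k (λ i → f (suc i))))
                           (sym (∑-+ k (f 0) (λ j → ∑ n (λ i → f (suc i) j))))

∑-const-1 : ∀ n → ∑ n (λ _ → 1) ≡ n
∑-const-1 zero    = refl
∑-const-1 (suc n) = cong suc (∑-const-1 n)

∑²-+ : ∀ n (f g : ℕ → ℕ → ℕ) → ∑² n (λ i j → f i j + g i j) ≡ ∑² n f + ∑² n g
∑²-+ n f g = trans (∑-cong n (λ i _ → ∑-+ n (f i) (g i))) (∑-+ n _ _)

𝟙-trichotomy : ∀ i j → 𝟙 (i <? j) + 𝟙 (i ≟ j) + 𝟙 (j <? i) ≡ 1
𝟙-trichotomy i j with <-cmp i j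
... | tri< a ¬b ¬c = cong₂ _+_ (cong₂ _+_ (𝟙-yes (i <? j) a) (𝟙-no (i ≟ j) ¬b)) (𝟙-no (j <? i) ¬c)
... | tri≈ ¬a b ¬c = cong₂ _+_ (cong₂ _+_ (𝟙-no (i <? j) ¬a) (𝟙-yes (i ≟ j) b)) (𝟙-no (j <? i) ¬c)
... | tri> ¬a ¬b c = cong₂ _+_ (cong₂ _+_ (𝟙-no (i <? j) ¬a) (𝟙-no (i ≟ j) ¬b)) (𝟙-yes (j <? i) c)

𝟙-trichotomy-split : ∀ i j x → x ≡ 𝟙 (i <? j) * x + 𝟙 (i ≟ j) * x + 𝟙 (j <? i) * x
𝟙-trichotomy-split i j x = begin
  x                                               ≡⟨ *-identityˡ x ⟨
  1 * x                                           ≡⟨ cong (_* x) (𝟙-trichotomy i j) ⟨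
  (𝟙 (i <? j) + 𝟙 (i ≟ j) + 𝟙 (j <? i)) * x       ≡⟨ *-distribʳ-+ x (𝟙 (i <? j) + 𝟙 (i ≟ j)) _ ⟩
  (𝟙 (i <? j) + 𝟙 (i ≟ j)) * x + 𝟙 (j <? i) * x   ≡⟨ cong (_+ 𝟙 (j <? i) * x) (*-distribʳ-+ x (𝟙 (i <? j)) _) ⟩
  𝟙 (i <? j) * x + 𝟙 (i ≟ j) * x + 𝟙 (j <? i) * x ∎
  where open ≡-Reasoning

upper : ℕ → (ℕ → ℕ → ℕ) → ℕ
upper n f = ∑² n (λ i j → 𝟙 (i <? j) * f i j)

∑²-symmetric : ∀ n (f : ℕ → ℕ → ℕ) → (∀ i j → f i j ≡ f j i) →
               ∑² n f ≡ upper n f + ∑ n (λ i → f i i) + upper n f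
∑²-symmetric n f f-sym = begin
  ∑² n f
    ≡⟨ ∑-cong n (λ i _ → ∑-cong n (λ j _ → 𝟙-trichotomy-split i j (f i j))) ⟩
  ∑² n (λ i j → lt i j + on i j + gt i j)      ≡⟨ ∑²-+ n (λ i j → lt i j + on i j) gt ⟩
  ∑² n (λ i j → lt i j + on i j) + ∑² n gt     ≡⟨ cong (_+ ∑² n gt) (∑²-+ n lt on) ⟩
  upper n f + ∑² n on + ∑² n gt                ≡⟨ cong₂ (λ x y → upper n f + x + y) diagonal lower ⟩
  upper n f + ∑ n (λ i → f i i) + upper n f    ∎
  where
  open ≡-Reasoning
  lt on gt : ℕ → ℕ → ℕ
  lt i j = 𝟙 (i <? j) * f i j
  on i j = 𝟙 (i ≟ j) * f i j
  gt i j = 𝟙 (j <? i) * f i j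

  diagonal : ∑² n on ≡ ∑ n (λ i → f i i)
  diagonal = ∑-cong n λ i i<n →
    trans (∑-single n i i<n (λ j _ j≢i → cong (_* f i j) (𝟙-no (i ≟ j) (j≢i ∘ sym))))
          (trans (cong (_* f i i) (𝟙-yes (i ≟ i) refl)) (*-identityˡ (f i i)))

  lower : ∑² n gt ≡ upper n f
  lower = trans (∑-swap n n gt) (∑-cong n λ i _ → ∑-cong n λ j _ → cong (𝟙 (i <? j) *_) (f-sym j i))

sum-filter-applyUpTo : ∀ {Q : Pred ℕ ℓ} (Q? : Decidable Q) (g : ℕ → ℕ) n →
                       sum (filter Q? (applyUpTo g n)) ≡ ∑ n (λ i → 𝟙 (Q? (g i)) * g i)
sum-filter-applyUpTo Q? g zero = refl
sum-filter-applyUpTo Q? g (suc n) with Q? (g 0)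
... | yes _ = cong₂ _+_ (sym (+-identityʳ (g 0))) (sum-filter-applyUpTo Q? (g ∘ suc) n)
... | no _  = sum-filter-applyUpTo Q? (g ∘ suc) n

-- Candidate divisors d ∈ {1, …, n} of n are indexed by i = d ∸ 1, i.e. they appear as suc i.
σ≡∑ : ∀ n → σ n ≡ ∑ n (λ i → 𝟙 (suc i ∣? n) * suc i)
σ≡∑ n = trans (cong (sum ∘ filter (_∣? n)) (map-applyUpTo (λ i → i) suc n))
              (sum-filter-applyUpTo (_∣? n) suc n)

τ : ℕ → ℕ
τ n = ∑ n (λ i → 𝟙 (suc i ∣? n))

∣-odd : ∀ {d n} → d ∣ n → n % 2 ≡ 1 → d % 2 ≡ 1
∣-odd {d} d∣n n-odd with d % 2 in d%2 | m%n<n d 2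
... | 0           | _ =
  contradiction (trans (sym (n∣m⇒m%n≡0 _ 2 (∣-trans (m%n≡0⇒n∣m d 2 d%2) d∣n))) n-odd) 0≢1+n
... | 1           | _ = refl
... | suc (suc _) | s<s (s<s ())

σ≡τ-mod-2 : ∀ n → n % 2 ≡ 1 → σ n % 2 ≡ τ n % 2
σ≡τ-mod-2 n n-odd = trans (cong (_% 2) (σ≡∑ n)) (∑-cong-% 2 n odd-term)
  where
  odd-term : ∀ i → i < n → 𝟙 (suc i ∣? n) * suc i % 2 ≡ 𝟙 (suc i ∣? n) % 2
  odd-term i _ with suc i ∣? n
  ... | yes i+1∣n = trans (cong (_% 2) (+-identityʳ (suc i))) (∣-odd i+1∣n n-odd)
  ... | no _      = refl

<-mono⇒injective : ∀ {f : ℕ → ℕ} → (∀ {a b} → a < b → f a < f b) → ∀ {a b} → f a ≡ f b → a ≡ b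
<-mono⇒injective {f} mono {a} {b} fa≡fb with <-cmp a b
... | tri< a<b _ _ = contradiction fa≡fb (<⇒≢ (mono a<b))
... | tri≈ _ a≡b _ = a≡b
... | tri> _ _ b<a = contradiction (sym fa≡fb) (<⇒≢ (mono b<a))

∑-cofactor : ∀ n .{{_ : NonZero n}} a → ∑ n (λ j → 𝟙 (suc a * suc j ≟ n)) ≡ 𝟙 (suc a ∣? n)
∑-cofactor n a with suc a ∣? n
... | no a+1∤n = ∑-zero n λ j _ → 𝟙-no (suc a * suc j ≟ n)
                   (λ eq → a+1∤n (divides (suc j) (trans (sym eq) (*-comm (suc a) (suc j)))))
... | yes (divides zero n≡0) = contradiction n≡0 (≢-nonZero⁻¹ n)
... | yes (divides (suc q) n≡q+1*a+1) =
  trans (∑-single n q q<n others)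
        (𝟙-yes (suc a * suc q ≟ n) (trans (*-comm (suc a) (suc q)) (sym n≡q+1*a+1)))
  where
  q<n : q < n
  q<n = subst (suc q ≤_) (sym n≡q+1*a+1) (m≤m*n (suc q) (suc a))
  others : ∀ j → j < n → j ≢ q → 𝟙 (suc a * suc j ≟ n) ≡ 0
  others j _ j≢q = 𝟙-no (suc a * suc j ≟ n) λ eq → j≢q (suc-injective
    (*-cancelˡ-≡ (suc j) (suc q) (suc a) (trans eq (trans n≡q+1*a+1 (*-comm (suc q) (suc a))))))

τ≡∑² : ∀ n .{{_ : NonZero n}} → τ n ≡ ∑² n (λ i j → 𝟙 (suc i * suc j ≟ n))
τ≡∑² n = ∑-cong n (λ i _ → sym (∑-cofactor n i))

τ-square-odd : ∀ a .{{_ : NonZero a}} → τ (a * a) % 2 ≡ 1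
τ-square-odd (suc a) = begin
  τ n % 2                                              ≡⟨ cong (_% 2) (τ≡∑² n) ⟩
  ∑² n factorises % 2                                  ≡⟨ cong (_% 2) (∑²-symmetric n factorises factorises-sym) ⟩
  (upper n factorises + ∑ n (λ i → factorises i i) + upper n factorises) % 2
    ≡⟨ cong (λ x → (upper n factorises + x + upper n factorises) % 2) square-root-unique ⟩
  (upper n factorises + 1 + upper n factorises) % 2    ≡⟨ u+1+u-odd (upper n factorises) ⟩
  1                                                    ∎
  where
  open ≡-Reasoning
  n : ℕ
  n = suc a * suc a
  factorises : ℕ → ℕ → ℕ
  factorises i j = 𝟙 (suc i * suc j ≟ n)
  factorises-sym : ∀ i j → factorises i j ≡ factorises j i
  factorises-sym i j = cong (λ x → 𝟙 (x ≟ n)) (*-comm (suc i) (suc j))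
  square-root-unique : ∑ n (λ i → factorises i i) ≡ 1
  square-root-unique = trans
    (∑-single n a (m≤m*n (suc a) (suc a)) λ i _ i≢a → 𝟙-no (suc i * suc i ≟ n)
       (i≢a ∘ suc-injective ∘ <-mono⇒injective (λ b<c → *-mono-< b<c b<c)))
    (𝟙-yes (n ≟ n) refl)
  u+1+u-odd : ∀ u → (u + 1 + u) % 2 ≡ 1
  u+1+u-odd u = trans (cong (_% 2) (solve 1 (λ u → u :+ con 1 :+ u := con 1 :+ u :* con 2) refl u))
                ([m+kn]%n≡m%n 1 u 2)
    where open +-*-Solver

^-monoʳ-∣ : ∀ p {e k} → e ≤ k → p ^ e ∣ p ^ k
^-monoʳ-∣ p {e} {k} e≤k = divides (p ^ (k ∸ e)) (begin
  p ^ k                ≡⟨ cong (p ^_) (m+[n∸m]≡n e≤k) ⟨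
  p ^ (e + (k ∸ e))    ≡⟨ ^-distribˡ-+-* p e (k ∸ e) ⟩
  p ^ e * p ^ (k ∸ e)  ≡⟨ *-comm (p ^ e) _ ⟩
  p ^ (k ∸ e) * p ^ e  ∎)
  where open ≡-Reasoning

prime-∤⇒coprime : ∀ {p d} → Prime p → ¬ p ∣ d → Coprime d p
prime-∤⇒coprime {p} {d} p-prime p∤d with prime⇒irreducible p-prime (gcd[m,n]∣n d p)
... | inj₁ gcd≡1 = gcd≡1⇒coprime gcd≡1
... | inj₂ gcd≡p = contradiction (subst (_∣ d) gcd≡p (gcd[m,n]∣m d p)) p∤d

prime-power-divisor : ∀ {p} → Prime p → ∀ k {d} → d ∣ p ^ k → ∃ λ e → e ≤ k × d ≡ p ^ e
prime-power-divisor p-prime zero d∣1 = 0 , z≤n , ∣1⇒≡1 d∣1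
prime-power-divisor {p} p-prime (suc k) {d} d∣ with p ∣? d
... | no p∤d with prime-power-divisor p-prime k (coprime-divisor (prime-∤⇒coprime p-prime p∤d) d∣)
...   | e , e≤k , d≡p^e = e , m≤n⇒m≤1+n e≤k , d≡p^e
prime-power-divisor {p} p-prime (suc k) d∣ | yes (divides q refl)
  with prime-power-divisor p-prime k
         (*-cancelʳ-∣ {q} p {{prime⇒nonZero p-prime}} (subst (q * p ∣_) (*-comm p (p ^ k)) d∣))
...   | e , e≤k , q≡p^e = suc e , s≤s e≤k , trans (cong (_* p) q≡p^e) (*-comm (p ^ e) p)

∑-𝟙-suc-≟ : ∀ n c .{{_ : NonZero c}} → c ≤ n → ∑ n (λ i → 𝟙 (suc i ≟ c)) ≡ 1
∑-𝟙-suc-≟ n c c≤n = trans (∑-single n (pred c) (subst (_≤ n) (sym (suc-pred c)) c≤n) others)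
                           (𝟙-yes (suc (pred c) ≟ c) (suc-pred c))
  where
  others : ∀ i → i < n → i ≢ pred c → 𝟙 (suc i ≟ c) ≡ 0
  others i _ i≢c-1 = 𝟙-no (suc i ≟ c) (i≢c-1 ∘ cong pred)

τ-prime-power : ∀ {p} → Prime p → ∀ k → τ (p ^ k) ≡ suc k
τ-prime-power {p} p-prime k = begin
  ∑ n (λ i → 𝟙 (suc i ∣? n))                       ≡⟨ ∑-cong n (λ i _ → divisor-as-power i) ⟩
  ∑ n (λ i → ∑ (suc k) (λ e → 𝟙 (suc i ≟ p ^ e)))  ≡⟨ ∑-swap n (suc k) (λ i e → 𝟙 (suc i ≟ p ^ e)) ⟩
  ∑ (suc k) (λ e → ∑ n (λ i → 𝟙 (suc i ≟ p ^ e)))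
    ≡⟨ ∑-cong (suc k) (λ e e≤k → ∑-𝟙-suc-≟ n (p ^ e) {{m^n≢0 p e}} (^-monoʳ-≤ p (≤-pred e≤k))) ⟩
  ∑ (suc k) (λ _ → 1)                              ≡⟨ ∑-const-1 (suc k) ⟩
  suc k                                            ∎
  where
  open ≡-Reasoning
  instance
    p≢0 : NonZero p
    p≢0 = prime⇒nonZero p-prime
  n : ℕ
  n = p ^ k
  ^-injective : ∀ {e f} → p ^ e ≡ p ^ f → e ≡ f
  ^-injective = <-mono⇒injective (^-monoʳ-< p (nonTrivial⇒n>1 p {{prime⇒nonTrivial p-prime}}))
  divisor-as-power : ∀ i → 𝟙 (suc i ∣? n) ≡ ∑ (suc k) (λ e → 𝟙 (suc i ≟ p ^ e))
  divisor-as-power i with suc i ∣? n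
  ... | no i+1∤n = sym (∑-zero (suc k) λ e e≤k → 𝟙-no (suc i ≟ p ^ e)
                     λ i+1≡p^e → i+1∤n (subst (_∣ n) (sym i+1≡p^e) (^-monoʳ-∣ p (≤-pred e≤k))))
  ... | yes i+1∣n with prime-power-divisor p-prime k i+1∣n
  ...   | e , e≤k , i+1≡p^e = sym (trans
    (∑-single (suc k) e (s≤s e≤k) λ f _ f≢e → 𝟙-no (suc i ≟ p ^ f)
       λ i+1≡p^f → f≢e (^-injective (trans (sym i+1≡p^f) i+1≡p^e)))
    (𝟙-yes (suc i ≟ p ^ e) i+1≡p^e))

lemma4p2p7 : (N p k m : ℕ) → N % 2 ≡ 1 → σ N ≡ 2 * N → Prime p → k ≥ 1 → m ≥ 1 → N ≡ p ^ k * m ^ 2 → p % 4 ≡ 1 → k % 4 ≡ 1 → Coprime p m → ¬ (σ (p ^ k) ≡ σ (m ^ 2))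
lemma4p2p7 N p k m@(suc _) N-odd _ p-prime _ _ N≡p^k*m² _ k%4≡1 _ σ-equal = 0≢1+n (begin
  0                                 ≡⟨ σ[p^k]-even ⟨
  σ (p ^ k) % 2                     ≡⟨ cong (_% 2) σ-equal ⟩
  σ (m ^ 2) % 2                     ≡⟨ σ≡τ-mod-2 (m ^ 2) (∣-odd (divides (p ^ k) N≡p^k*m²) N-odd) ⟩
  τ (m ^ 2) % 2                     ≡⟨ cong (λ x → τ x % 2) (cong (m *_) (*-identityʳ m)) ⟩
  τ (m * m) % 2                     ≡⟨ τ-square-odd m ⟩
  1                                 ∎)
  where
  open ≡-Reasoning
  p^k-odd : p ^ k % 2 ≡ 1
  p^k-odd = ∣-odd (divides (m ^ 2) (trans N≡p^k*m² (*-comm (p ^ k) (m ^ 2)))) N-odd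
  k-odd : k % 2 ≡ 1
  k-odd = trans (sym (m∣n⇒o%n%m≡o%m 2 4 k (divides 2 refl))) (cong (_% 2) k%4≡1)
  σ[p^k]-even : σ (p ^ k) % 2 ≡ 0
  σ[p^k]-even = begin
    σ (p ^ k) % 2            ≡⟨ σ≡τ-mod-2 (p ^ k) p^k-odd ⟩
    τ (p ^ k) % 2            ≡⟨ cong (_% 2) (τ-prime-power p-prime k) ⟩
    (1 + k) % 2              ≡⟨ %-distribˡ-+ 1 k 2 ⟩
    (1 + k % 2) % 2          ≡⟨ cong (λ x → (1 + x) % 2) k-odd ⟩
    0                        ∎
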